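{- There are infinitely many positive integers $N$ for which there are infinitely many pairs $(A, B)$ of antipalindromic numbers with $N = A/B$.
   Context: A positive integer is antipalindromic if its base-$2$ representation (without leading zeros) $w_1 \cdots w_{2m}$ has even length and satisfies $w_i + w_{2m+1-i} = 1$ for all $i$ (the second half is the reverse complement of the first half). -}

module Defs where

open import Data.Nat using (ℕ; zero; suc; _+_; _*_; _<_)
open import Data.Bool using (Bool; true; false; not)
open import Data.Fin using (Fin; zero; suc; opposite)
open import Data.Vec using (Vec; []; _∷_; lookup; foldl)
open import Data.Product using (Σ; ∃; _×_; _,_)
open import Relation.Binary.PropositionalEquality using (_≡_)

bitVal : Bool → ℕ
bitVal true  = 1
bitVal false = 0

value : ∀ {k} → Vec Bool k → ℕ
value = foldl (λ _ → ℕ) (λ acc b → 2 * acc + bitVal b) 0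

NoLeadingZero : ∀ {k} → Vec Bool k → Set
NoLeadingZero []      = Data.Empty.⊥ where import Data.Empty
NoLeadingZero (b ∷ _) = b ≡ true

-- n is antipalindromic: its binary representation w₁⋯w_{2m} has even
-- length and w_i + w_{2m+1-i} = 1 for all i, i.e. w_{2m+1-i} = not w_i.
Antipalindromic : ℕ → Set
Antipalindromic n =
  Σ ℕ λ m → Σ (Vec Bool (m + m)) λ w →
    NoLeadingZero w × value w ≡ n ×
    (∀ (i : Fin (m + m)) → lookup w (opposite i) ≡ not (lookup w i))

-- Write c = 2^(t+1) − 1.  Reading a word most-significant-bit first, appending a block u to x
-- gives val (x ++ u) = val x · 2^|u| + val u, so if val x = c · val y, val u = c · val v and
-- |u| = |v| then val (x ++ u) = c · val (y ++ v).  Starting from 1^(t+1) = c · 1 and using the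
-- blocks 0 1^t 0 1 0^t 1 = c · (0^(t+2) 1^(t+2)), both of which equal their reverse complement,
-- we get for every k the antipalindromes
--   A = 1^(t+1) (0 1^t 0 1 0^t 1)^k 0^(t+1)   and   B = 1 (0^(t+2) 1^(t+2))^k 0
-- with A = 2^t (2^(t+1) − 1) · B, and B grows with k.
module Submission where

open import Defs
open import Data.Nat using (ℕ; zero; suc; _+_; _*_; _∸_; _^_; _<_; _≤_; z≤n; s≤s)
open import Data.Nat.Properties
  using (+-suc; +-comm; *-assoc; *-identityˡ; *-identityʳ; +-identityʳ; *-distribˡ-+; m+n∸m≡n; m≤m+n; m≤m*n; m^n≢0;
         m^n>0; ^-monoʳ-≤; +-mono-≤; ≤-trans; ≤-reflexive; module ≤-Reasoning)
open import Data.Nat.Tactic.RingSolver using (solve-∀)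
open import Data.Bool using (Bool; true; false; not)
open import Data.Bool.Properties using (not-involutive; not-¬)
import Data.Fin as Fin
open import Data.Fin using (Fin; toℕ; opposite)
open import Data.Fin.Properties using (opposite-prop; toℕ-fromℕ<; toℕ-injective)
open import Data.List using (List; []; _∷_; _++_; [_]; concat; replicate; length; map; reverse; foldl)
open import Data.List.Properties
  using (map-∘; map-cong; map-id; reverse-map; reverse-++; reverse-involutive; map-++; ++-assoc;
         ++-identityʳ; foldl-++; length-++; length-map; length-reverse; length-replicate)
import Data.Vec as Vec
open import Data.Vec using (Vec; lookup; fromList; toList; _∷ʳ_)
open import Data.Vec.Properties using (reverse-∷; lookup-map; toList-injective; toList-reverse; toList-map; toList∘fromList)
open import Data.Vec.Relation.Binary.Equality.Cast using (cast-is-id)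
open import Data.Product using (Σ; ∃; _×_; _,_)
open import Data.Sum using (_⊎_; inj₁; inj₂)
open import Data.Empty using (⊥-elim)
open import Relation.Binary.PropositionalEquality
  using (_≡_; refl; sym; trans; cong; cong₂; subst; module ≡-Reasoning)

private
  variable
    T : Set
    n : ℕ

lookup-∷ʳ-fromℕ : (xs : Vec T n) (x : T) → lookup (xs ∷ʳ x) (Fin.fromℕ n) ≡ x
lookup-∷ʳ-fromℕ Vec.[]       x = refl
lookup-∷ʳ-fromℕ (y Vec.∷ xs) x = lookup-∷ʳ-fromℕ xs x

lookup-∷ʳ-inject₁ : (xs : Vec T n) (x : T) (i : Fin n) → lookup (xs ∷ʳ x) (Fin.inject₁ i) ≡ lookup xs i
lookup-∷ʳ-inject₁ (y Vec.∷ xs) x Fin.zero    = refl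
lookup-∷ʳ-inject₁ (y Vec.∷ xs) x (Fin.suc i) = lookup-∷ʳ-inject₁ xs x i

lookup-reverse-opposite : (xs : Vec T n) (i : Fin n) → lookup (Vec.reverse xs) (opposite i) ≡ lookup xs i
lookup-reverse-opposite (x Vec.∷ xs) Fin.zero =
  trans (cong (λ ys → lookup ys (Fin.fromℕ _)) (reverse-∷ x xs)) (lookup-∷ʳ-fromℕ (Vec.reverse xs) x)
lookup-reverse-opposite (x Vec.∷ xs) (Fin.suc i) = begin
  lookup (Vec.reverse (x Vec.∷ xs)) j   ≡⟨ cong (λ ys → lookup ys j) (reverse-∷ x xs) ⟩
  lookup (Vec.reverse xs ∷ʳ x) j        ≡⟨ lookup-∷ʳ-inject₁ (Vec.reverse xs) x (opposite i) ⟩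
  lookup (Vec.reverse xs) (opposite i)  ≡⟨ lookup-reverse-opposite xs i ⟩
  lookup xs i                           ∎
  where
  open ≡-Reasoning
  j = Fin.inject₁ (opposite i)

IsAntipalindrome : Vec Bool n → Set
IsAntipalindrome {n} v = ∀ (i : Fin n) → lookup v (opposite i) ≡ not (lookup v i)

reverse-complement⇒IsAntipalindrome : (v : Vec Bool n) → Vec.reverse (Vec.map not v) ≡ v → IsAntipalindrome v
reverse-complement⇒IsAntipalindrome v rc-v i = begin
  lookup v (opposite i)                               ≡⟨ cong (λ u → lookup u (opposite i)) (sym rc-v) ⟩
  lookup (Vec.reverse (Vec.map not v)) (opposite i)   ≡⟨ lookup-reverse-opposite (Vec.map not v) i ⟩
  lookup (Vec.map not v) i                            ≡⟨ lookup-map i not v ⟩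
  not (lookup v i)                                    ∎
  where open ≡-Reasoning

even-or-odd : ∀ n → ∃ λ m → n ≡ m + m ⊎ n ≡ suc (m + m)
even-or-odd zero = 0 , inj₁ refl
even-or-odd (suc n) with even-or-odd n
... | m , inj₁ refl = m , inj₂ refl
... | m , inj₂ refl = suc m , inj₁ (cong suc (sym (+-suc m m)))

opposite-middle : ∀ m → ∃ λ (i : Fin (suc (m + m))) → opposite i ≡ i
opposite-middle m = middle , toℕ-injective (begin
  toℕ (opposite middle)  ≡⟨ opposite-prop middle ⟩
  (m + m) ∸ toℕ middle ≡⟨ cong ((m + m) ∸_) (toℕ-fromℕ< m<2m+1) ⟩
  (m + m) ∸ m   ≡⟨ m+n∸m≡n m m ⟩
  m                      ≡⟨ sym (toℕ-fromℕ< m<2m+1) ⟩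
  toℕ middle             ∎)
  where
  open ≡-Reasoning
  m<2m+1 : m < suc (m + m)
  m<2m+1 = s≤s (m≤m+n m m)
  middle : Fin (suc (m + m))
  middle = Fin.fromℕ< m<2m+1

-- An odd-length antipalindrome would have a middle bit equal to its own complement.
IsAntipalindrome⇒even : (v : Vec Bool n) → IsAntipalindrome v → ∃ λ m → n ≡ m + m
IsAntipalindrome⇒even {n} v anti with even-or-odd n
... | m , inj₁ n≡2m = m , n≡2m
... | m , inj₂ refl with opposite-middle m
...   | i , opp-i≡i = ⊥-elim (not-¬ refl (subst (λ j → lookup v j ≡ not (lookup v i)) opp-i≡i (anti i)))

IsAntipalindrome⇒Antipalindromic : (v : Vec Bool n) → NoLeadingZero v → IsAntipalindrome v →
                                   Antipalindromic (value v)
IsAntipalindrome⇒Antipalindromic v lead anti with IsAntipalindrome⇒even v anti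
... | m , refl = m , v , lead , refl , anti

rc : List Bool → List Bool
rc w = reverse (map not w)

rc-++ : (u v : List Bool) → rc (u ++ v) ≡ rc v ++ rc u
rc-++ u v = trans (cong reverse (map-++ not u v)) (reverse-++ (map not u) (map not v))

rc-involutive : (w : List Bool) → rc (rc w) ≡ w
rc-involutive w = begin
  reverse (map not (reverse (map not w))) ≡⟨ cong reverse (reverse-map not (map not w)) ⟩
  reverse (reverse (map not (map not w))) ≡⟨ reverse-involutive (map not (map not w)) ⟩
  map not (map not w)                     ≡⟨ sym (map-∘ w) ⟩
  map (λ b → not (not b)) w               ≡⟨ map-cong not-involutive w ⟩
  map (λ b → b) w                         ≡⟨ map-id w ⟩
  w                                       ∎
  where open ≡-Reasoning

replicate-∷ʳ : ∀ n (x : T) → replicate n x ++ [ x ] ≡ x ∷ replicate n x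
replicate-∷ʳ zero    x = refl
replicate-∷ʳ (suc n) x = cong (x ∷_) (replicate-∷ʳ n x)

rc-replicate : ∀ n b → rc (replicate n b) ≡ replicate n (not b)
rc-replicate zero    b = refl
rc-replicate (suc n) b = begin
  rc ([ b ] ++ replicate n b)       ≡⟨ rc-++ [ b ] (replicate n b) ⟩
  rc (replicate n b) ++ [ not b ]   ≡⟨ cong (_++ [ not b ]) (rc-replicate n b) ⟩
  replicate n (not b) ++ [ not b ]  ≡⟨ replicate-∷ʳ n (not b) ⟩
  replicate (suc n) (not b)         ∎
  where open ≡-Reasoning

rc-++-rc : (u : List Bool) → rc (u ++ rc u) ≡ u ++ rc u
rc-++-rc u = trans (rc-++ u (rc u)) (cong (_++ rc u) (rc-involutive u))

rc-frame : (x : List Bool) {r : List Bool} → rc r ≡ r → rc ((x ++ r) ++ rc x) ≡ (x ++ r) ++ rc x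
rc-frame x {r} rc-r = begin
  rc ((x ++ r) ++ rc x)        ≡⟨ rc-++ (x ++ r) (rc x) ⟩
  rc (rc x) ++ rc (x ++ r)     ≡⟨ cong₂ _++_ (rc-involutive x) (rc-++ x r) ⟩
  x ++ (rc r ++ rc x)          ≡⟨ cong (λ y → x ++ (y ++ rc x)) rc-r ⟩
  x ++ (r ++ rc x)             ≡⟨ sym (++-assoc x r (rc x)) ⟩
  (x ++ r) ++ rc x             ∎
  where open ≡-Reasoning

repeat : ℕ → List T → List T
repeat k xs = concat (replicate k xs)

repeat-∷ʳ : ∀ k (xs : List T) → repeat k xs ++ xs ≡ xs ++ repeat k xs
repeat-∷ʳ zero    xs = sym (++-identityʳ xs)
repeat-∷ʳ (suc k) xs = trans (++-assoc xs (repeat k xs) xs) (cong (xs ++_) (repeat-∷ʳ k xs))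

rc-repeat : ∀ k {r : List Bool} → rc r ≡ r → rc (repeat k r) ≡ repeat k r
rc-repeat zero    rc-r = refl
rc-repeat (suc k) {r} rc-r = begin
  rc (r ++ repeat k r)        ≡⟨ rc-++ r (repeat k r) ⟩
  rc (repeat k r) ++ rc r     ≡⟨ cong₂ _++_ (rc-repeat k rc-r) rc-r ⟩
  repeat k r ++ r             ≡⟨ repeat-∷ʳ k r ⟩
  r ++ repeat k r             ∎
  where open ≡-Reasoning

k≤length-repeat : ∀ k (x : T) xs → k ≤ length (repeat k (x ∷ xs))
k≤length-repeat zero    x xs = z≤n
k≤length-repeat (suc k) x xs = s≤s (≤-trans (k≤length-repeat k x xs) (begin
  length (repeat k (x ∷ xs))                  ≤⟨ m≤m+n (length (repeat k (x ∷ xs))) (length xs) ⟩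
  length (repeat k (x ∷ xs)) + length xs      ≡⟨ +-comm (length (repeat k (x ∷ xs))) (length xs) ⟩
  length xs + length (repeat k (x ∷ xs))      ≡⟨ sym (length-++ xs) ⟩
  length (xs ++ repeat k (x ∷ xs))            ∎))
  where open ≤-Reasoning

length-++-rc : (u : List Bool) → length (u ++ rc u) ≡ length u + length u
length-++-rc u = trans (length-++ u) (cong (length u +_) (trans (length-reverse (map not u)) (length-map not u)))

ones zeros : ℕ → List Bool
ones n = replicate n true
zeros n = replicate n false

horner : ℕ → List Bool → ℕ
horner = foldl (λ acc b → 2 * acc + bitVal b)

val : List Bool → ℕ
val = horner 0

foldl-fromList : {B : Set} (f : B → T → B) (acc : B) (w : List T) →
                 Vec.foldl (λ _ → B) f acc (fromList w) ≡ foldl f acc w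
foldl-fromList f acc []      = refl
foldl-fromList f acc (x ∷ w) = foldl-fromList f (f acc x) w

horner-acc : ∀ acc w → horner acc w ≡ acc * 2 ^ length w + val w
horner-acc acc []      = sym (trans (+-identityʳ (acc * 1)) (*-identityʳ acc))
horner-acc acc (b ∷ w) = begin
  horner (2 * acc + β) w                       ≡⟨ horner-acc (2 * acc + β) w ⟩
  (2 * acc + β) * p + val w                    ≡⟨ shift acc β p (val w) ⟩
  acc * (2 * p) + ((2 * 0 + β) * p + val w)    ≡⟨ cong (acc * (2 * p) +_) (sym (horner-acc (2 * 0 + β) w)) ⟩
  acc * (2 * p) + val (b ∷ w)                  ∎
  where
  open ≡-Reasoning
  β = bitVal b
  p = 2 ^ length w
  shift : ∀ a β p v → (2 * a + β) * p + v ≡ a * (2 * p) + ((2 * 0 + β) * p + v)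
  shift = solve-∀

val-++ : (u v : List Bool) → val (u ++ v) ≡ val u * 2 ^ length v + val v
val-++ u v = trans (foldl-++ _ 0 u v) (horner-acc (val u) v)

horner-replicate : ∀ acc n b → horner acc (replicate n b) ≡ acc * 2 ^ n + val (replicate n b)
horner-replicate acc n b =
  trans (horner-acc acc (replicate n b)) (cong (λ l → acc * 2 ^ l + val (replicate n b)) (length-replicate n))

val-zeros : ∀ n → val (zeros n) ≡ 0
val-zeros zero    = refl
val-zeros (suc n) = val-zeros n

2^n≡1+val-ones : ∀ n → 2 ^ n ≡ suc (val (ones n))
2^n≡1+val-ones zero    = refl
2^n≡1+val-ones (suc n) = begin
  2 * 2 ^ n                                   ≡⟨ cong (2 *_) (2^n≡1+val-ones n) ⟩
  2 * suc x                                   ≡⟨ double x ⟩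
  suc (1 * suc x + x)                         ≡⟨ cong (λ p → suc (1 * p + x)) (sym (2^n≡1+val-ones n)) ⟩
  suc (1 * 2 ^ n + x)                         ≡⟨ cong suc (sym (horner-replicate 1 n true)) ⟩
  suc (val (ones (suc n)))                    ∎
  where
  open ≡-Reasoning
  x = val (ones n)
  double : ∀ x → 2 * suc x ≡ suc (1 * suc x + x)
  double = solve-∀

val-++-zeros : ∀ w n → val (w ++ zeros n) ≡ val w * 2 ^ n
val-++-zeros w n = begin
  val (w ++ zeros n)                                  ≡⟨ val-++ w (zeros n) ⟩
  val w * 2 ^ length (zeros n) + val (zeros n)        ≡⟨ cong₂ (λ l z → val w * 2 ^ l + z) (length-replicate n) (val-zeros n) ⟩
  val w * 2 ^ n + 0                                   ≡⟨ +-identityʳ (val w * 2 ^ n) ⟩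
  val w * 2 ^ n                                       ∎
  where open ≡-Reasoning

2^length≤val : (w : List Bool) → 2 ^ length w ≤ val (true ∷ w)
2^length≤val w = begin
  2 ^ length w                ≡⟨ sym (*-identityˡ (2 ^ length w)) ⟩
  1 * 2 ^ length w            ≤⟨ m≤m+n (1 * 2 ^ length w) (val w) ⟩
  1 * 2 ^ length w + val w    ≡⟨ sym (horner-acc 1 w) ⟩
  val (true ∷ w)              ∎
  where open ≤-Reasoning

n<2^n : ∀ n → n < 2 ^ n
n<2^n zero    = s≤s z≤n
n<2^n (suc n) = begin-strict
  suc n              <⟨ +-mono-≤ (m^n>0 2 n) (n<2^n n) ⟩
  2 ^ n + 2 ^ n      ≡⟨ cong (2 ^ n +_) (sym (+-identityʳ (2 ^ n))) ⟩
  2 * 2 ^ n          ∎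
  where open ≤-Reasoning

scale-++ : ∀ c x y u v → val x ≡ c * val y → val u ≡ c * val v → length u ≡ length v →
           val (x ++ u) ≡ c * val (y ++ v)
scale-++ c x y u v x≈y u≈v |u|≡|v| = begin
  val (x ++ u)                               ≡⟨ val-++ x u ⟩
  val x * 2 ^ length u + val u               ≡⟨ cong₂ (λ a l → a * 2 ^ l + val u) x≈y |u|≡|v| ⟩
  c * val y * 2 ^ length v + val u           ≡⟨ cong (c * val y * 2 ^ length v +_) u≈v ⟩
  c * val y * 2 ^ length v + c * val v       ≡⟨ cong (_+ c * val v) (*-assoc c (val y) (2 ^ length v)) ⟩
  c * (val y * 2 ^ length v) + c * val v     ≡⟨ sym (*-distribˡ-+ c (val y * 2 ^ length v) (val v)) ⟩
  c * (val y * 2 ^ length v + val v)         ≡⟨ cong (c *_) (sym (val-++ y v)) ⟩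
  c * val (y ++ v)                           ∎
  where open ≡-Reasoning

scale-repeat : ∀ c u v → val u ≡ c * val v → length u ≡ length v →
               ∀ k x y → val x ≡ c * val y → val (x ++ repeat k u) ≡ c * val (y ++ repeat k v)
scale-repeat c u v u≈v |u|≡|v| zero x y x≈y =
  trans (cong val (++-identityʳ x)) (trans x≈y (cong (λ z → c * val z) (sym (++-identityʳ y))))
scale-repeat c u v u≈v |u|≡|v| (suc k) x y x≈y = begin
  val (x ++ (u ++ repeat k u))        ≡⟨ cong val (sym (++-assoc x u (repeat k u))) ⟩
  val ((x ++ u) ++ repeat k u)        ≡⟨ scale-repeat c u v u≈v |u|≡|v| k (x ++ u) (y ++ v) xu≈yv ⟩
  c * val ((y ++ v) ++ repeat k v)    ≡⟨ cong (λ z → c * val z) (++-assoc y v (repeat k v)) ⟩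
  c * val (y ++ (v ++ repeat k v))    ∎
  where
  open ≡-Reasoning
  xu≈yv = scale-++ c x y u v x≈y u≈v |u|≡|v|

rc-fixed⇒IsAntipalindrome : (w : List Bool) → rc w ≡ w → IsAntipalindrome (fromList w)
rc-fixed⇒IsAntipalindrome w rc-w =
  reverse-complement⇒IsAntipalindrome v (trans (sym (cast-is-id refl _)) (toList-injective refl _ v toList-eq))
  where
  open ≡-Reasoning
  v = fromList w
  toList-eq : toList (Vec.reverse (Vec.map not v)) ≡ toList v
  toList-eq = begin
    toList (Vec.reverse (Vec.map not v))  ≡⟨ toList-reverse (Vec.map not v) ⟩
    reverse (toList (Vec.map not v))      ≡⟨ cong reverse (toList-map not v) ⟩
    rc (toList v)                         ≡⟨ cong rc (toList∘fromList w) ⟩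
    rc w                                  ≡⟨ rc-w ⟩
    w                                     ≡⟨ sym (toList∘fromList w) ⟩
    toList v                              ∎

antipalindromic-val : (w : List Bool) → rc (true ∷ w) ≡ true ∷ w → Antipalindromic (val (true ∷ w))
antipalindromic-val w rc-w =
  subst Antipalindromic (foldl-fromList _ 0 (true ∷ w))
    (IsAntipalindrome⇒Antipalindromic (fromList (true ∷ w)) refl (rc-fixed⇒IsAntipalindrome (true ∷ w) rc-w))

module Construction (t : ℕ) where

  lead half blockA blockB : List Bool
  lead   = ones (suc t)
  half   = false ∷ ones t ++ [ false ]
  blockA = half ++ rc half
  blockB = zeros (2 + t) ++ rc (zeros (2 + t))

  A B : ℕ → List Bool
  A k = (lead ++ repeat k blockA) ++ rc lead
  B k = ([ true ] ++ repeat k blockB) ++ rc [ true ]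

  c N : ℕ
  c = val lead
  N = c * 2 ^ t

  length-blockA≡length-blockB : length blockA ≡ length blockB
  length-blockA≡length-blockB = begin
    length blockA                                   ≡⟨ length-++-rc half ⟩
    length half + length half                       ≡⟨ cong (λ l → l + l) length-half ⟩
    length (zeros (2 + t)) + length (zeros (2 + t)) ≡⟨ sym (length-++-rc (zeros (2 + t))) ⟩
    length blockB                                   ∎
    where
    open ≡-Reasoning
    length-half : length half ≡ length (zeros (2 + t))
    length-half = cong suc (begin
      length (ones t ++ [ false ])  ≡⟨ length-++ (ones t) ⟩
      length (ones t) + 1           ≡⟨ cong (_+ 1) (length-replicate t) ⟩
      t + 1                         ≡⟨ +-comm t 1 ⟩
      suc t                         ≡⟨ sym (length-replicate (suc t)) ⟩
      length (zeros (suc t))        ∎)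

  rc-half : rc half ≡ true ∷ zeros t ++ [ true ]
  rc-half = begin
    rc ([ false ] ++ (ones t ++ [ false ]))  ≡⟨ rc-++ [ false ] (ones t ++ [ false ]) ⟩
    rc (ones t ++ [ false ]) ++ [ true ]     ≡⟨ cong (_++ [ true ]) (rc-++ (ones t) [ false ]) ⟩
    (true ∷ rc (ones t)) ++ [ true ]         ≡⟨ cong (λ z → (true ∷ z) ++ [ true ]) (rc-replicate t true) ⟩
    true ∷ zeros t ++ [ true ]               ∎
    where open ≡-Reasoning

  val-blockA : val blockA ≡ 2 * ((2 * (2 * val (ones t) + 0) + 1) * 2 ^ t + 0) + 1
  val-blockA = begin
    val (half ++ rc half)                                   ≡⟨ foldl-++ _ 0 half (rc half) ⟩
    horner (val half) (rc half)                             ≡⟨ cong (horner (val half)) rc-half ⟩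
    horner (val half) (true ∷ zeros t ++ [ true ])          ≡⟨ foldl-++ _ (2 * val half + 1) (zeros t) [ true ] ⟩
    2 * horner (2 * val half + 1) (zeros t) + 1             ≡⟨ cong (λ h → 2 * h + 1) (horner-replicate _ t false) ⟩
    2 * ((2 * val half + 1) * 2 ^ t + val (zeros t)) + 1    ≡⟨ cong₂ (λ h z → 2 * ((2 * h + 1) * 2 ^ t + z) + 1)
                                                                     (foldl-++ _ 0 (ones t) [ false ]) (val-zeros t) ⟩
    2 * ((2 * (2 * val (ones t) + 0) + 1) * 2 ^ t + 0) + 1  ∎
    where open ≡-Reasoning

  val-blockB : val blockB ≡ val (ones (2 + t))
  val-blockB = trans (foldl-++ _ 0 (zeros (2 + t)) (rc (zeros (2 + t))))
                     (cong₂ horner (val-zeros (2 + t)) (rc-replicate (2 + t) false))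

  val-blockA≡c*val-blockB : val blockA ≡ c * val blockB
  val-blockA≡c*val-blockB = begin
    val blockA                                   ≡⟨ val-blockA ⟩
    2 * ((2 * (2 * x + 0) + 1) * 2 ^ t + 0) + 1  ≡⟨ cong (λ p → 2 * ((2 * (2 * x + 0) + 1) * p + 0) + 1) 2^t≡1+x ⟩
    2 * ((2 * (2 * x + 0) + 1) * suc x + 0) + 1  ≡⟨ factor x ⟩
    (1 * suc x + x) * (3 * suc x + x)            ≡⟨ cong (λ p → (1 * p + x) * (3 * p + x)) (sym 2^t≡1+x) ⟩
    (1 * 2 ^ t + x) * (3 * 2 ^ t + x)            ≡⟨ cong₂ _*_ (sym (horner-replicate 1 t true)) (sym (horner-replicate 3 t true)) ⟩
    c * val (ones (2 + t))                       ≡⟨ cong (c *_) (sym val-blockB) ⟩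
    c * val blockB                               ∎
    where
    open ≡-Reasoning
    x = val (ones t)
    2^t≡1+x : 2 ^ t ≡ suc x
    2^t≡1+x = 2^n≡1+val-ones t
    factor : ∀ x → 2 * ((2 * (2 * x + 0) + 1) * suc x + 0) + 1 ≡ (1 * suc x + x) * (3 * suc x + x)
    factor = solve-∀

  val-A : ∀ k → val (A k) ≡ c * val ([ true ] ++ repeat k blockB) * 2 ^ suc t
  val-A k = begin
    val ((lead ++ repeat k blockA) ++ rc lead)             ≡⟨ cong (λ z → val ((lead ++ repeat k blockA) ++ z)) (rc-replicate (suc t) true) ⟩
    val ((lead ++ repeat k blockA) ++ zeros (suc t))       ≡⟨ val-++-zeros (lead ++ repeat k blockA) (suc t) ⟩
    val (lead ++ repeat k blockA) * 2 ^ suc t              ≡⟨ cong (_* 2 ^ suc t) lead-prefix ⟩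
    c * val ([ true ] ++ repeat k blockB) * 2 ^ suc t      ∎
    where
    open ≡-Reasoning
    lead-prefix : val (lead ++ repeat k blockA) ≡ c * val ([ true ] ++ repeat k blockB)
    lead-prefix = scale-repeat c blockA blockB val-blockA≡c*val-blockB length-blockA≡length-blockB
                    k lead [ true ] (sym (*-identityʳ c))

  val-A≡N*val-B : ∀ k → val (A k) ≡ N * val (B k)
  val-A≡N*val-B k = begin
    val (A k)                            ≡⟨ val-A k ⟩
    c * X * (2 * 2 ^ t)                  ≡⟨ regroup c X (2 ^ t) ⟩
    c * 2 ^ t * (X * (2 * 1))            ≡⟨ cong (N *_) (sym (val-++-zeros ([ true ] ++ repeat k blockB) 1)) ⟩
    N * val (B k)                        ∎
    where
    open ≡-Reasoning
    X = val ([ true ] ++ repeat k blockB)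
    regroup : ∀ c X p → c * X * (2 * p) ≡ c * p * (X * (2 * 1))
    regroup = solve-∀

  antipalindromic-A : ∀ k → Antipalindromic (val (A k))
  antipalindromic-A k = antipalindromic-val _ (rc-frame lead (rc-repeat k (rc-++-rc half)))

  antipalindromic-B : ∀ k → Antipalindromic (val (B k))
  antipalindromic-B k = antipalindromic-val _ (rc-frame [ true ] (rc-repeat k (rc-++-rc (zeros (2 + t)))))

  k<val-B : ∀ k → k < val (B k)
  k<val-B k = begin-strict
    k                            <⟨ n<2^n k ⟩
    2 ^ k                        ≤⟨ ^-monoʳ-≤ 2 (≤-trans (k≤length-repeat k false _) |w|≤) ⟩
    2 ^ length (w ++ [ false ])  ≤⟨ 2^length≤val (w ++ [ false ]) ⟩
    val (B k)                    ∎
    where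
    open ≤-Reasoning
    w = repeat k blockB
    |w|≤ : length w ≤ length (w ++ [ false ])
    |w|≤ = ≤-trans (m≤m+n (length w) 1) (≤-reflexive (sym (length-++ w)))

  t<N : t < N
  t<N = begin-strict
    t                    <⟨ n<2^n t ⟩
    2 ^ t                ≡⟨ cong (2 ^_) (sym (length-replicate t)) ⟩
    2 ^ length (ones t)  ≤⟨ 2^length≤val (ones t) ⟩
    c                    ≤⟨ m≤m*n c (2 ^ t) {{m^n≢0 2 t}} ⟩
    N                    ∎
    where open ≤-Reasoning

theorem20 : ∀ (k : ℕ) → Σ ℕ λ N → k < N × 0 < N ×
              (∀ (j : ℕ) → Σ ℕ λ A → Σ ℕ λ B →
                j < B × Antipalindromic A × Antipalindromic B × A ≡ N * B)
theorem20 k = N , t<N , ≤-trans (s≤s z≤n) t<N ,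
  λ j → val (A j) , val (B j) , k<val-B j , antipalindromic-A j , antipalindromic-B j , val-A≡N*val-B j
  where open Construction k
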